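{- Let $m, k, g$ be positive integers with $m > k$, and let $A \in \mathcal A_k$. Then the numerical semigroups with multiplicity $m$, type $(A; k)$, and genus $g$ are exactly the sets of the form \[ \Lambda = \{0\} \cup (m + A) \cup \big(2m + (A + A)\cap[0, k]\big) \cup B \cup [2m + k + 1, \infty) \] where $B$ is any subset of $[m+k+1, 2m+k-1] \setminus (2m + A + A)$ with exactly $2m + k - |A| - |(A + A)\cap[0, k]| - g$ elements. Furthermore, the number of such numerical semigroups equals \[ \binom{m - 1 - |(A + A)\cap[0, k]|}{g + |A|-m-k - 1}. \]
   Context: A numerical semigroup is a subset $\Lambda\subset\mathbb{N}_0$ closed under addition, containing $0$, with finite complement in $\mathbb{N}_0$; its multiplicity is its smallest nonzero element, its Frobenius number $f(\Lambda)$ is the largest element of $\mathbb{N}_0\setminus\Lambda$, and its genus is $|\mathbb{N}_0\setminus\Lambda|$. For integers $a\le b$, $[a,b]=\{a,\dots,b\}$, $[a,\infty)=\{a,a+1,\dots\}$. For $A\subset\mathbb{Z}$, $b\in\mathbb{Z}$: $A+A=\{a_1+a_2:a_1,a_2\in A\}$, $b+A=\{a+b:a\in A\}$. For a positive integer $k$, $\mathcal A_k=\{A\subset[0,k-1]: 0\in A,\ k\notin A+A\}$. A numerical semigroup $\Lambda$ with multiplicity $m$ and Frobenius number $f$ with $2m<f<3m$ has type $(A;k)$ (with $k<m$ a positive integer, $A\in\mathcal A_k$) if $f=2m+k$ and $\Lambda\cap[m,m+k]=A+m$. Convention: $\binom{a}{b}=0$ unless $0\le b\le a$. -}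

module Defs where

open import Data.Bool using (Bool; true; false; _∧_; _∨_; if_then_else_)
open import Data.Nat using (ℕ; zero; suc; _+_; _*_; _∸_; _≤_; _<_)
open import Data.Nat.Combinatorics using (_C_)
open import Data.Integer using (ℤ; +_; -[1+_])
open import Data.Product using (Σ; _×_; _,_)
open import Data.Sum using (_⊎_)
open import Data.Empty using (⊥)
open import Data.List using (List; length)
open import Data.List.Relation.Unary.All using (All)
open import Data.List.Relation.Unary.Any using (Any)
open import Data.List.Relation.Unary.AllPairs using (AllPairs)
open import Relation.Nullary using (¬_)
open import Relation.Binary.PropositionalEquality using (_≡_)

SubsetN : Set
SubsetN = ℕ → Bool

infix 4 _∈_
_∈_ : ℕ → SubsetN → Set
n ∈ S = S n ≡ true

_≐_ : SubsetN → SubsetN → Set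
S ≐ T = ∀ n → S n ≡ T n

infix 2 _⇔_
_⇔_ : Set → Set → Set
P ⇔ Q = (P → Q) × (Q → P)

count : SubsetN → ℕ → ℕ
count S zero = zero
count S (suc N) = (if S N then suc (count S N) else count S N)

countNot : SubsetN → ℕ → ℕ
countNot S zero = zero
countNot S (suc N) = (if S N then countNot S N else suc (countNot S N))

anyUpTo : (ℕ → Bool) → ℕ → Bool
anyUpTo f zero = f zero
anyUpTo f (suc s) = f (suc s) ∨ anyUpTo f s

sumset : SubsetN → SubsetN
sumset A s = anyUpTo (λ a → A a ∧ A (s ∸ a)) s

sumsetUpTo : SubsetN → ℕ → SubsetN
sumsetUpTo A k s = if s Data.Nat.≤ᵇ k then sumset A s else false

record IsNumericalSemigroup (Λ : SubsetN) : Set where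
  field
    zero∈ : 0 ∈ Λ
    closed : ∀ a b → a ∈ Λ → b ∈ Λ → a + b ∈ Λ
    cofinite : Σ ℕ λ N → ∀ n → N ≤ n → n ∈ Λ

Multiplicity : SubsetN → ℕ → Set
Multiplicity Λ m = (0 < m) × (m ∈ Λ) × (∀ n → 0 < n → n < m → ¬ (n ∈ Λ))

Frobenius : SubsetN → ℕ → Set
Frobenius Λ f = ¬ (f ∈ Λ) × (∀ n → f < n → n ∈ Λ)

Genus : SubsetN → ℕ → Set
Genus Λ g = Σ ℕ λ N → (∀ n → N ≤ n → n ∈ Λ) × (countNot Λ N ≡ g)

InCalA : ℕ → SubsetN → Set
InCalA k A = (∀ a → a ∈ A → a < k) × (0 ∈ A)
           × ¬ (Σ ℕ λ a₁ → Σ ℕ λ a₂ → a₁ ∈ A × a₂ ∈ A × a₁ + a₂ ≡ k)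

HasType : SubsetN → ℕ → SubsetN → ℕ → Set
HasType Λ m A k = Σ ℕ λ f → Frobenius Λ f × (2 * m < f) × (f < 3 * m)
                 × (f ≡ 2 * m + k) × (0 < k) × (k < m) × InCalA k A
                 × (∀ n → (m ≤ n × n ≤ m + k × n ∈ Λ) ⇔ (Σ ℕ λ a → a ∈ A × n ≡ a + m))

InForm : ℕ → ℕ → SubsetN → SubsetN → ℕ → Set
InForm m k A B n =
    (n ≡ 0)
  ⊎ (Σ ℕ λ a → a ∈ A × n ≡ m + a)
  ⊎ (Σ ℕ λ s → s ∈ sumsetUpTo A k × n ≡ 2 * m + s)
  ⊎ (n ∈ B)
  ⊎ (2 * m + k + 1 ≤ n)

-- B ⊆ [m+k+1, 2m+k-1] ∖ (2m + A + A) with exactly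
-- 2m + k - |A| - |(A+A) ∩ [0,k]| - g elements (written additively to avoid
-- truncated subtraction).
ValidB : ℕ → ℕ → SubsetN → ℕ → SubsetN → Set
ValidB m k A g B =
    (∀ n → n ∈ B → (m + k + 1 ≤ n) × (n < 2 * m + k)
                   × ¬ (Σ ℕ λ s → s ∈ sumset A × n ≡ 2 * m + s))
  × (count B (2 * m + k) + count A k + count (sumsetUpTo A k) (suc k) + g
       ≡ 2 * m + k)

-- Binomial coefficient with integer arguments: binom a b = 0 unless 0 ≤ b ≤ a.
binomℤ : ℤ → ℤ → ℕ
binomℤ (+ a) (+ b) = a C b
binomℤ _ _ = 0

SemigroupOfType : ℕ → SubsetN → ℕ → ℕ → SubsetN → Set
SemigroupOfType m A k g Λ =
  IsNumericalSemigroup Λ × Multiplicity Λ m × HasType Λ m A k × Genus Λ g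

-- The class of subsets satisfying P has exactly c elements (up to ≐):
-- there is a duplicate-free list of length c of members, containing every member.
HasCardinality : (SubsetN → Set) → ℕ → Set
HasCardinality P c = Σ (List SubsetN) λ L →
    (length L ≡ c) × All P L × AllPairs (λ Λ₁ Λ₂ → ¬ (Λ₁ ≐ Λ₂)) L
  × (∀ Λ → P Λ → Any (λ Λ′ → Λ ≐ Λ′) L)

module Submission where

-- A semigroup Λ of multiplicity m and type (A; k) has Frobenius number f = 2m + k, so it contains
-- every n > f, meets [0, m + k] exactly in {0} ∪ (m + A), and by closure contains 2m + (A + A) ∩ [0, k].
-- The remaining positions of [m + k + 1, f) outside 2m + (A + A), the unforced ones, are free: for any
-- set B of unforced positions the union is closed, because a sum of two nonzero elements is either
-- (m + a) + (m + a′), which lies in 2m + (A + A) ∩ [0, k] or beyond f, or already exceeds f. So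
-- Λ ↦ Λ ∩ unforced is a bijection onto the sets of unforced positions whose size is fixed by the genus,
-- and as k ∉ A + A there are exactly m − 1 − |(A + A) ∩ [0, k]| unforced positions.

open import Defs
open import Data.Bool using (true; false; _∧_; _∨_; not; if_then_else_; T)
open import Data.Nat using (ℕ; zero; suc; _+_; _*_; _∸_; _≤_; _<_; _≤′_; ≤′-refl; ≤′-step; z≤n; s≤s; _≤ᵇ_; _≡ᵇ_; _≤?_; _<?_; _≟_)
open import Data.Nat.Properties
open import Data.Nat.Tactic.RingSolver using (solve-∀)
open import Data.Nat.Combinatorics using (_C_; nCk≡nC[n∸k]; nCk+nC[k+1]≡[n+1]C[k+1])
open import Data.Integer as ℤ using (ℤ; +_)
import Data.Integer.Properties as ℤ
import Data.Integer.Tactic.RingSolver as ℤ-Solver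
open import Data.Product using (Σ; _×_; _,_; proj₁; proj₂)
import Data.Product as Product
open import Data.Sum using (_⊎_; inj₁; inj₂)
import Data.Sum as Sum
open import Data.Empty using (⊥-elim)
open import Function using (id; _∘_)
open import Data.List using (List; []; _∷_; length; map; _++_)
open import Data.List.Properties using (length-++; length-map)
open import Data.List.Relation.Unary.All as All using (All; []; _∷_)
import Data.List.Relation.Unary.All.Properties as AllP
open import Data.List.Relation.Unary.Any as Any using (Any; here)
import Data.List.Relation.Unary.Any.Properties as AnyP
open import Data.List.Relation.Unary.AllPairs as AP using (AllPairs; []; _∷_)
import Data.List.Relation.Unary.AllPairs.Properties as APP
open import Relation.Nullary using (¬_; yes; no; does; contradiction)
open import Relation.Unary using (Decidable)
open import Relation.Binary.PropositionalEquality
open import Data.Bool.Properties using (∧-identityʳ)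
import Data.Bool.Properties as Bool using (_≟_)

∨-≡-true : ∀ x {y} → x ∨ y ≡ true ⇔ (x ≡ true ⊎ y ≡ true)
∨-≡-true true  = (λ _ → inj₁ refl) , (λ _ → refl)
∨-≡-true false = inj₂ , Sum.[ (λ ()) , id ]

∧-≡-true : ∀ x {y} → x ∧ y ≡ true ⇔ (x ≡ true × y ≡ true)
∧-≡-true true  = (refl ,_) , proj₂
∧-≡-true false = (λ ()) , (λ ())

not-≡-true : ∀ x → not x ≡ true ⇔ (¬ x ≡ true)
not-≡-true true  = (λ ()) , (λ x≢true → contradiction refl x≢true)
not-≡-true false = (λ _ ()) , (λ _ → refl)

≡-true-ext : ∀ x y → (x ≡ true ⇔ y ≡ true) → x ≡ y
≡-true-ext true  _     (x⇒y , _) = sym (x⇒y refl)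
≡-true-ext false true  (_ , y⇒x) = y⇒x refl
≡-true-ext false false _         = refl

T⇒≡true : ∀ {x} → T x → x ≡ true
T⇒≡true {true} _ = refl

≡true⇒T : ∀ {x} → x ≡ true → T x
≡true⇒T refl = _

¬≡true⇒≡false : ∀ {x} → ¬ x ≡ true → x ≡ false
¬≡true⇒≡false {true}  x≢true = contradiction refl x≢true
¬≡true⇒≡false {false} _      = refl

infixr 6 _∪_
infixr 7 _∩_ _∖_
infixr 8 _⊕_

_∪_ _∩_ _∖_ : SubsetN → SubsetN → SubsetN
(X ∪ Y) n = X n ∨ Y n
(X ∩ Y) n = X n ∧ Y n
(X ∖ Y) n = X n ∧ not (Y n)

_⊕_ : ℕ → SubsetN → SubsetN
(c ⊕ X) n = if c ≤ᵇ n then X (n ∸ c) else false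

⟦_⟧ : {P : ℕ → Set} → Decidable P → SubsetN
⟦ P? ⟧ n = does (P? n)

Characterises : SubsetN → (ℕ → Set) → Set
Characterises X P = ∀ n → n ∈ X ⇔ P n

∈-characterises : ∀ X → Characterises X (_∈ X)
∈-characterises X n = id , id

⟦⟧-characterises : ∀ {P} (P? : Decidable P) → Characterises ⟦ P? ⟧ P
⟦⟧-characterises P? n with P? n
... | yes p = (λ _ → p) , (λ _ → refl)
... | no ¬p = (λ ()) , (λ p → contradiction p ¬p)

module _ {X Y P Q} (X↔P : Characterises X P) (Y↔Q : Characterises Y Q) where

  ∪-characterises : Characterises (X ∪ Y) (λ n → P n ⊎ Q n)
  ∪-characterises n =
      Sum.map (proj₁ (X↔P n)) (proj₁ (Y↔Q n)) ∘ proj₁ (∨-≡-true (X n))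
    , proj₂ (∨-≡-true (X n)) ∘ Sum.map (proj₂ (X↔P n)) (proj₂ (Y↔Q n))

  ∩-characterises : Characterises (X ∩ Y) (λ n → P n × Q n)
  ∩-characterises n =
      Product.map (proj₁ (X↔P n)) (proj₁ (Y↔Q n)) ∘ proj₁ (∧-≡-true (X n))
    , proj₂ (∧-≡-true (X n)) ∘ Product.map (proj₂ (X↔P n)) (proj₂ (Y↔Q n))

  ∖-characterises : Characterises (X ∖ Y) (λ n → P n × ¬ Q n)
  ∖-characterises n =
      Product.map (proj₁ (X↔P n)) (λ ∉Y → proj₁ (not-≡-true (Y n)) ∉Y ∘ proj₂ (Y↔Q n))
        ∘ proj₁ (∧-≡-true (X n))
    , proj₂ (∧-≡-true (X n))
        ∘ Product.map (proj₂ (X↔P n)) (λ ¬q → proj₂ (not-≡-true (Y n)) (¬q ∘ proj₁ (Y↔Q n)))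

⊕-characterises : ∀ c {X P} → Characterises X P
                → Characterises (c ⊕ X) (λ n → Σ ℕ λ i → P i × n ≡ c + i)
⊕-characterises c {X} X↔P n with c ≤ᵇ n in c≤ᵇn
... | true  = let c≤n = ≤ᵇ⇒≤ c n (≡true⇒T c≤ᵇn) in
              (λ n-c∈X → n ∸ c , proj₁ (X↔P _) n-c∈X , sym (m+[n∸m]≡n c≤n))
              , (λ (i , p , n≡c+i) → subst (λ z → X (z ∸ c) ≡ true) (sym n≡c+i)
                                       (trans (cong X (m+n∸m≡n c i)) (proj₂ (X↔P i) p)))
... | false = (λ ())
              , (λ (i , _ , n≡c+i) → ⊥-elim (subst T c≤ᵇn (≤⇒≤ᵇ (subst (c ≤_) (sym n≡c+i) (m≤m+n c i)))))

characterises-≐ : ∀ {X Y P} → Characterises X P → Characterises Y P → X ≐ Y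
characterises-≐ X↔P Y↔P n =
  ≡-true-ext _ _ (proj₂ (Y↔P n) ∘ proj₁ (X↔P n) , proj₂ (X↔P n) ∘ proj₁ (Y↔P n))

count-cong : ∀ {X Y} N → (∀ n → n < N → X n ≡ Y n) → count X N ≡ count Y N
count-cong zero    _   = refl
count-cong (suc N) X≡Y
  rewrite X≡Y N ≤-refl | count-cong N (λ n n<N → X≡Y n (m<n⇒m<1+n n<N)) = refl

count-+ : ∀ X a L → count X (a + L) ≡ count X a + count (λ i → X (a + i)) L
count-+ X a zero    rewrite +-identityʳ a = sym (+-identityʳ _)
count-+ X a (suc L) rewrite +-suc a L with X (a + L)
... | true  = trans (cong suc (count-+ X a L)) (sym (+-suc _ _))
... | false = count-+ X a L

count-suc-false : ∀ X N → X N ≡ false → count X (suc N) ≡ count X N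
count-suc-false X N N∉X rewrite N∉X = refl

count-suc-true : ∀ X N → N ∈ X → count X (suc N) ≡ suc (count X N)
count-suc-true X N N∈X rewrite N∈X = refl

count-none : ∀ X N → (∀ n → n < N → X n ≡ false) → count X N ≡ 0
count-none X zero    _    = refl
count-none X (suc N) none rewrite none N ≤-refl = count-none X N (λ n n<N → none n (m<n⇒m<1+n n<N))

count-all : ∀ X N → (∀ n → n < N → X n ≡ true) → count X N ≡ N
count-all X zero    _   = refl
count-all X (suc N) all rewrite all N ≤-refl = cong suc (count-all X N (λ n n<N → all n (m<n⇒m<1+n n<N)))

count-∪ : ∀ X Y N → (∀ n → n < N → n ∈ X → Y n ≡ false)
        → count (X ∪ Y) N ≡ count X N + count Y N
count-∪ X Y zero    _        = refl
count-∪ X Y (suc N) disjoint with X N in N∈X | Y N in N∈Y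
... | true  | true  = contradiction (trans (sym N∈Y) (disjoint N ≤-refl N∈X)) λ ()
... | true  | false = cong suc (count-∪ X Y N (λ n n<N → disjoint n (m<n⇒m<1+n n<N)))
... | false | true  = trans (cong suc (count-∪ X Y N (λ n n<N → disjoint n (m<n⇒m<1+n n<N))))
                            (sym (+-suc _ _))
... | false | false = count-∪ X Y N (λ n n<N → disjoint n (m<n⇒m<1+n n<N))

count+countNot : ∀ X N → count X N + countNot X N ≡ N
count+countNot X zero    = refl
count+countNot X (suc N) with X N
... | true  = cong suc (count+countNot X N)
... | false = trans (+-suc _ _) (cong suc (count+countNot X N))

count-not : ∀ X N → count (not ∘ X) N ≡ countNot X N
count-not X zero    = refl
count-not X (suc N) with X N
... | true  = count-not X N
... | false = cong suc (count-not X N)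

⊕-below : ∀ c X n → n < c → (c ⊕ X) n ≡ false
⊕-below c X n n<c with c ≤ᵇ n in c≤ᵇn
... | true  = contradiction (≤ᵇ⇒≤ c n (≡true⇒T c≤ᵇn)) (<⇒≱ n<c)
... | false = refl

⊕-shifted : ∀ c X i → (c ⊕ X) (c + i) ≡ X i
⊕-shifted c X i rewrite T⇒≡true (≤⇒≤ᵇ (m≤m+n c i)) | m+n∸m≡n c i = refl

count-⊕ : ∀ c X L → count (c ⊕ X) (c + L) ≡ count X L
count-⊕ c X L = begin
  count (c ⊕ X) (c + L)                                 ≡⟨ count-+ (c ⊕ X) c L ⟩
  count (c ⊕ X) c + count (λ i → (c ⊕ X) (c + i)) L     ≡⟨ cong₂ _+_ (count-none _ c (⊕-below c X))
                                                                     (count-cong L (λ i _ → ⊕-shifted c X i)) ⟩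
  count X L                                             ∎
  where open ≡-Reasoning

module _ (X : SubsetN) {N : ℕ} where

  count-stable : ∀ {M} → N ≤ M → (∀ n → N ≤ n → X n ≡ false) → count X M ≡ count X N
  count-stable N≤M none = go (≤⇒≤′ N≤M)
    where
    go : ∀ {M} → N ≤′ M → count X M ≡ count X N
    go ≤′-refl = refl
    go (≤′-step {M} N≤′M) rewrite none M (≤′⇒≤ N≤′M) = go N≤′M

  countNot-stable : ∀ {M} → N ≤ M → (∀ n → N ≤ n → X n ≡ true) → countNot X M ≡ countNot X N
  countNot-stable N≤M all = go (≤⇒≤′ N≤M)
    where
    go : ∀ {M} → N ≤′ M → countNot X M ≡ countNot X N
    go ≤′-refl = refl
    go (≤′-step {M} N≤′M) rewrite all M (≤′⇒≤ N≤′M) = go N≤′M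

-- Enumerating classes of sets

-- Members are told apart at a point of X, so that distinctness survives maps which are faithful only on X.
Apart : SubsetN → SubsetN → SubsetN → Set
Apart X B B′ = Σ ℕ λ n → n ∈ X × ¬ B n ≡ B′ n

record Enumeration (X : SubsetN) (Q : SubsetN → Set) (c : ℕ) : Set where
  field
    members        : List SubsetN
    length-members : length members ≡ c
    sound          : All Q members
    apart          : AllPairs (Apart X) members
    complete       : ∀ B → Q B → Any (B ≐_) members

Enumeration⇒HasCardinality : ∀ {X Q c} → Enumeration X Q c → HasCardinality Q c
Enumeration⇒HasCardinality e = members , length-members , sound
                              , AP.map (λ (n , _ , Bn≢B′n) B≐B′ → Bn≢B′n (B≐B′ n)) apart , complete
  where open Enumeration e

Enumeration-map : ∀ {X Y Q R c} (F G : SubsetN → SubsetN)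
  → (∀ {B B′} → Apart X B B′ → Apart Y (F B) (F B′))
  → (∀ {B B′} → B ≐ B′ → F B ≐ F B′)
  → (∀ {B} → Q B → R (F B))
  → (∀ {Λ} → R Λ → Q (G Λ) × Λ ≐ F (G Λ))
  → Enumeration X Q c → Enumeration Y R c
Enumeration-map F G F-apart F-cong Q⇒R R⇒Q e = record
  { members        = map F members
  ; length-members = trans (length-map F members) length-members
  ; sound          = AllP.map⁺ (All.map Q⇒R sound)
  ; apart          = APP.map⁺ (AP.map F-apart apart)
  ; complete       = λ Λ RΛ → let (QGΛ , Λ≐FGΛ) = R⇒Q RΛ in
      AnyP.map⁺ (Any.map (λ GΛ≐B n → trans (Λ≐FGΛ n) (F-cong GΛ≐B n)) (complete (G Λ) QGΛ))
  }
  where open Enumeration e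

-- Subsets of a given size

∅ : SubsetN
∅ _ = false

below : ℕ → SubsetN
below N = ⟦ _<? N ⟧

insert erase : ℕ → SubsetN → SubsetN
insert N B = ⟦ _≟ N ⟧ ∪ B
erase  N B = B ∖ ⟦ _≟ N ⟧

Support : SubsetN → ℕ → SubsetN → Set
Support P N B = ∀ n → n ∈ B → n < N × n ∈ P

SizedSubset : SubsetN → ℕ → ℕ → SubsetN → Set
SizedSubset P N j B = Support P N B × count B N ≡ j

subsets : SubsetN → ℕ → ℕ → List SubsetN
subsets P zero    zero    = ∅ ∷ []
subsets P zero    (suc j) = []
subsets P (suc N) zero    = subsets P N zero
subsets P (suc N) (suc j) =
  if P N then subsets P N (suc j) ++ map (insert N) (subsets P N j) else subsets P N (suc j)

∩below-characterises : ∀ X N → Characterises (X ∩ below N) (λ n → n ∈ X × n < N)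
∩below-characterises X N = ∩-characterises (∈-characterises X) (⟦⟧-characterises (_<? N))

insert-≢ : ∀ {N n} B → n ≢ N → insert N B n ≡ B n
insert-≢ {N} {n} B n≢N with n ≡ᵇ N in n≡ᵇN
... | true  = contradiction (≡ᵇ⇒≡ n N (≡true⇒T n≡ᵇN)) n≢N
... | false = refl

erase-≢ : ∀ {N n} B → n ≢ N → erase N B n ≡ B n
erase-≢ {N} {n} B n≢N with n ≡ᵇ N in n≡ᵇN
... | true  = contradiction (≡ᵇ⇒≡ n N (≡true⇒T n≡ᵇN)) n≢N
... | false = ∧-identityʳ (B n)

insert-top : ∀ N B → N ∈ insert N B
insert-top N B rewrite T⇒≡true (≡⇒≡ᵇ N N refl) = refl

insert-cong : ∀ N {B B′} → B ≐ B′ → insert N B ≐ insert N B′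
insert-cong N B≐B′ n = cong (does (n ≟ N) ∨_) (B≐B′ n)

insert-erase : ∀ N B → N ∈ B → B ≐ insert N (erase N B)
insert-erase N B N∈B = characterises-≐ (∈-characterises B) (λ n →
    Sum.[ (λ n≡N → subst (_∈ B) (sym n≡N) N∈B) , proj₁ ] ∘ proj₁ (char n) , case-≟ n)
  where
  char = ∪-characterises (⟦⟧-characterises (_≟ N))
                         (∖-characterises (∈-characterises B) (⟦⟧-characterises (_≟ N)))
  case-≟ : ∀ n → n ∈ B → n ∈ insert N (erase N B)
  case-≟ n n∈B with n ≟ N
  ... | yes n≡N = proj₂ (char n) (inj₁ n≡N)
  ... | no  n≢N = proj₂ (char n) (inj₂ (n∈B , n≢N))

module _ {P : SubsetN} {N : ℕ} where

  Support-top : ∀ {B} → Support P N B → B N ≡ false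
  Support-top {B} supp = ¬≡true⇒≡false (λ N∈B → n≮n N (proj₁ (supp N N∈B)))

  widen : ∀ {j B} → SizedSubset P N j B → SizedSubset P (suc N) j B
  widen {B = B} (supp , size) =
    (λ n n∈B → Product.map₁ m<n⇒m<1+n (supp n n∈B)) , trans (count-suc-false B N (Support-top supp)) size

  narrow : ∀ {j B} → SizedSubset P (suc N) j B → B N ≡ false → SizedSubset P N j B
  narrow {B = B} (supp , size) N∉B = (λ n n∈B → Product.map₁ (<-below n n∈B) (supp n n∈B))
                                   , trans (sym (count-suc-false B N N∉B)) size
    where
    <-below : ∀ n → n ∈ B → n < suc N → n < N
    <-below n n∈B n<1+N = ≤∧≢⇒< (≤-pred n<1+N) λ n≡N →
      contradiction (trans (sym (subst (_∈ B) n≡N n∈B)) N∉B) λ ()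

  insert-sized : ∀ {j B} → N ∈ P → SizedSubset P N j B → SizedSubset P (suc N) (suc j) (insert N B)
  insert-sized {B = B} N∈P sized@(supp , size) = supp′ , size′
    where
    supp′ : Support P (suc N) (insert N B)
    supp′ n = Sum.[ (λ { refl → ≤-refl , N∈P }) , proj₁ (widen sized) n ]
            ∘ proj₁ (∪-characterises (⟦⟧-characterises (_≟ N)) (∈-characterises B) n)
    size′ = begin
      count (insert N B) (suc N)  ≡⟨ count-suc-true (insert N B) N (insert-top N B) ⟩
      suc (count (insert N B) N)  ≡⟨ cong suc (count-cong N (λ n n<N → insert-≢ B (<⇒≢ n<N))) ⟩
      suc (count B N)             ≡⟨ cong suc size ⟩
      suc _                       ∎
      where open ≡-Reasoning

  erase-sized : ∀ {j B} → SizedSubset P (suc N) (suc j) B → N ∈ B → SizedSubset P N j (erase N B)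
  erase-sized {B = B} (supp , size) N∈B = supp′ , size′
    where
    supp′ : Support P N (erase N B)
    supp′ n n∈B∖N =
      let (n∈B , n≢N)   = proj₁ (∖-characterises (∈-characterises B) (⟦⟧-characterises (_≟ N)) n) n∈B∖N
          (n<1+N , n∈P) = supp n n∈B in
      ≤∧≢⇒< (≤-pred n<1+N) n≢N , n∈P
    size′ = trans (count-cong N (λ n n<N → erase-≢ B (<⇒≢ n<N)))
                  (suc-injective (trans (sym (count-suc-true B N N∈B)) size))

  apart-widen : ∀ {B B′} → Apart (P ∩ below N) B B′ → Apart (P ∩ below (suc N)) B B′
  apart-widen (n , n∈P∩<N , Bn≢B′n) = let (n∈P , n<N) = proj₁ (∩below-characterises P N n) n∈P∩<N in
    n , proj₂ (∩below-characterises P (suc N) n) (n∈P , m<n⇒m<1+n n<N) , Bn≢B′n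

  apart-insert : ∀ {B B′} → Apart (P ∩ below N) B B′ → Apart (P ∩ below (suc N)) (insert N B) (insert N B′)
  apart-insert {B} {B′} B#B′@(n , n∈P∩<N , Bn≢B′n) =
    n , proj₁ (proj₂ (apart-widen B#B′))
      , λ eq → Bn≢B′n (trans (sym (insert-≢ B n≢N)) (trans eq (insert-≢ B′ n≢N)))
    where n≢N = <⇒≢ (proj₂ (proj₁ (∩below-characterises P N n) n∈P∩<N))

  apart-top : ∀ {B} B′ → N ∈ P → Support P N B → Apart (P ∩ below (suc N)) B (insert N B′)
  apart-top B′ N∈P supp = N , proj₂ (∩below-characterises P (suc N) N) (N∈P , ≤-refl)
                        , λ eq → contradiction (trans (sym (Support-top supp)) (trans eq (insert-top N B′))) λ ()

module _ (P : SubsetN) where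

  length-subsets : ∀ N j → length (subsets P N j) ≡ count P N C j
  length-subsets zero    zero    = refl
  length-subsets zero    (suc j) = refl
  length-subsets (suc N) zero    = length-subsets N zero
  length-subsets (suc N) (suc j) with P N
  ... | false = length-subsets N (suc j)
  ... | true  = begin
    length (subsets P N (suc j) ++ map (insert N) (subsets P N j))
      ≡⟨ length-++ (subsets P N (suc j)) ⟩
    length (subsets P N (suc j)) + length (map (insert N) (subsets P N j))
      ≡⟨ cong₂ _+_ (length-subsets N (suc j))
                   (trans (length-map (insert N) (subsets P N j)) (length-subsets N j)) ⟩
    count P N C suc j + count P N C j
      ≡⟨ +-comm _ (count P N C j) ⟩
    count P N C j + count P N C suc j
      ≡⟨ nCk+nC[k+1]≡[n+1]C[k+1] (count P N) j ⟩
    suc (count P N) C suc j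
      ∎
    where open ≡-Reasoning

  subsets-sound : ∀ N j → All (SizedSubset P N j) (subsets P N j)
  subsets-sound zero    zero    = ((λ _ ()) , refl) ∷ []
  subsets-sound zero    (suc j) = []
  subsets-sound (suc N) zero    = All.map widen (subsets-sound N zero)
  subsets-sound (suc N) (suc j) with P N in N∈P
  ... | false = All.map widen (subsets-sound N (suc j))
  ... | true  = AllP.++⁺ (All.map widen (subsets-sound N (suc j)))
                         (AllP.map⁺ (All.map (insert-sized N∈P) (subsets-sound N j)))

  subsets-apart : ∀ N j → AllPairs (Apart (P ∩ below N)) (subsets P N j)
  subsets-apart zero    zero    = [] ∷ []
  subsets-apart zero    (suc j) = []
  subsets-apart (suc N) zero    = AP.map apart-widen (subsets-apart N zero)
  subsets-apart (suc N) (suc j) with P N in N∈P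
  ... | false = AP.map apart-widen (subsets-apart N (suc j))
  ... | true  = APP.++⁺ (AP.map apart-widen (subsets-apart N (suc j)))
                        (APP.map⁺ (AP.map apart-insert (subsets-apart N j)))
                        (All.map (λ (supp , _) → AllP.map⁺ (All.tabulate λ {B′} _ → apart-top B′ N∈P supp))
                                 (subsets-sound N (suc j)))

  subsets-complete : ∀ N j B → SizedSubset P N j B → Any (B ≐_) (subsets P N j)
  subsets-complete zero    zero    B (supp , _) = here λ n → ¬≡true⇒≡false (λ n∈B → n≮0 (proj₁ (supp n n∈B)))
  subsets-complete zero    (suc j) B (_ , ())
  subsets-complete (suc N) zero    B sized with B N Bool.≟ true
  ... | yes N∈B = contradiction (trans (sym (count-suc-true B N N∈B)) (proj₂ sized)) λ ()
  ... | no  N∉B = subsets-complete N zero B (narrow sized (¬≡true⇒≡false N∉B))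
  subsets-complete (suc N) (suc j) B sized with P N in N∈P | B N Bool.≟ true
  ... | false | yes N∈B = contradiction (trans (sym (proj₂ (proj₁ sized N N∈B))) N∈P) λ ()
  ... | false | no  N∉B = subsets-complete N (suc j) B (narrow sized (¬≡true⇒≡false N∉B))
  ... | true  | no  N∉B = AnyP.++⁺ˡ (subsets-complete N (suc j) B (narrow sized (¬≡true⇒≡false N∉B)))
  ... | true  | yes N∈B = AnyP.++⁺ʳ (subsets P N (suc j)) (AnyP.map⁺ (Any.map
        (λ B∖N≐B′ n → trans (insert-erase N B N∈B n) (insert-cong N B∖N≐B′ n))
        (subsets-complete N j (erase N B) (erase-sized sized N∈B))))

  subsets-enumeration : ∀ N j → Enumeration (P ∩ below N) (SizedSubset P N j) (count P N C j)
  subsets-enumeration N j = record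
    { members        = subsets P N j
    ; length-members = length-subsets N j
    ; sound          = subsets-sound N j
    ; apart          = subsets-apart N j
    ; complete       = subsets-complete N j
    }

-- Binomial coefficients with an integer lower index

C-vanishes : ∀ {n k} → n < k → n C k ≡ 0
C-vanishes {n} {k} n<k
  rewrite ¬≡true⇒≡false {k ≤ᵇ n} (λ k≤ᵇn → <⇒≱ n<k (≤ᵇ⇒≤ k n (≡true⇒T k≤ᵇn))) = refl

+m-+n≡+[m∸n] : ∀ {m n} → n ≤ m → + m ℤ.- + n ≡ + (m ∸ n)
+m-+n≡+[m∸n] {m} {n} n≤m = trans (ℤ.m-n≡m⊖n m n) (ℤ.⊖-≥ n≤m)

C≡binomℤ-complement : ∀ n j → n C j ≡ binomℤ (+ n) (+ n ℤ.- + j)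
C≡binomℤ-complement n j with j ≤? n
... | yes j≤n = trans (nCk≡nC[n∸k] j≤n) (sym (cong (binomℤ (+ n)) (+m-+n≡+[m∸n] j≤n)))
... | no  j≰n = begin
  n C j                             ≡⟨ C-vanishes n<j ⟩
  0                                 ≡⟨ binomℤ-negative (m<n⇒0<n∸m n<j) ⟨
  binomℤ (+ n) (ℤ.- + (j ∸ n))      ≡⟨ cong (binomℤ (+ n)) (trans (ℤ.m-n≡m⊖n n j) (ℤ.⊖-< n<j)) ⟨
  binomℤ (+ n) (+ n ℤ.- + j)        ∎
  where
  open ≡-Reasoning
  n<j = ≰⇒> j≰n
  binomℤ-negative : ∀ {x} → 0 < x → binomℤ (+ n) (ℤ.- + x) ≡ 0
  binomℤ-negative {suc x} _ = refl

upper-index : ∀ {m} p s → suc (p + s) ≡ m → + m ℤ.- + 1 ℤ.- + s ≡ + p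
upper-index p s refl = eq (+ p) (+ s)
  where
  eq : ∀ (p s : ℤ) → + 1 ℤ.+ (p ℤ.+ s) ℤ.- + 1 ℤ.- s ≡ p
  eq = ℤ-Solver.solve-∀

lower-index : ∀ {m} p s a g k → suc (p + s) ≡ m
            → + g ℤ.+ + a ℤ.- + m ℤ.- + k ℤ.- + 1 ≡ + (a + s + g + p) ℤ.- + (2 * m + k)
lower-index p s a g k refl = eq (+ p) (+ s) (+ a) (+ g) (+ k)
  where
  eq : ∀ (p s a g k : ℤ) → g ℤ.+ a ℤ.- (+ 1 ℤ.+ (p ℤ.+ s)) ℤ.- k ℤ.- + 1
                         ≡ a ℤ.+ s ℤ.+ g ℤ.+ p ℤ.- ((+ 1 ℤ.+ (p ℤ.+ s)) ℤ.+ ((+ 1 ℤ.+ (p ℤ.+ s)) ℤ.+ + 0) ℤ.+ k)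
  eq = ℤ-Solver.solve-∀

empty-enumeration : ∀ {X Q} → (∀ B → ¬ Q B) → Enumeration X Q 0
empty-enumeration ¬Q = record
  { members = [] ; length-members = refl ; sound = [] ; apart = [] ; complete = λ B QB → contradiction QB (¬Q B) }

codimension-enumeration : ∀ P N c
  → Enumeration (P ∩ below N) (λ B → Support P N B × count B N + c ≡ N)
                (binomℤ (+ count P N) (+ (c + count P N) ℤ.- + N))
codimension-enumeration P N c with c ≤? N
... | yes c≤N = subst (Enumeration _ _) binom-eq
      (Enumeration-map id id id (λ B≐B′ → B≐B′) size⇒codim codim⇒size (subsets-enumeration P N j))
  where
  j = N ∸ c
  j+c≡N : j + c ≡ N
  j+c≡N = m∸n+n≡m c≤N
  size⇒codim : ∀ {B} → SizedSubset P N j B → Support P N B × count B N + c ≡ N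
  size⇒codim (supp , size) = supp , trans (cong (_+ c) size) j+c≡N
  codim⇒size : ∀ {B} → Support P N B × count B N + c ≡ N → SizedSubset P N j B × B ≐ B
  codim⇒size (supp , codim) = (supp , +-cancelʳ-≡ c _ _ (trans codim (sym j+c≡N))) , λ _ → refl
  binom-eq : count P N C j ≡ binomℤ (+ count P N) (+ (c + count P N) ℤ.- + N)
  binom-eq = trans (C≡binomℤ-complement (count P N) j) (cong (binomℤ (+ count P N)) (begin
    + count P N ℤ.- + j                          ≡⟨ shift (+ c) (+ count P N) (+ j) ⟩
    + (c + count P N) ℤ.- + (j + c)              ≡⟨ cong (λ M → + (c + count P N) ℤ.- + M) j+c≡N ⟩
    + (c + count P N) ℤ.- + N                    ∎))
    where
    open ≡-Reasoning
    shift : ∀ (c n j : ℤ) → n ℤ.- j ≡ (c ℤ.+ n) ℤ.- (j ℤ.+ c)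
    shift = ℤ-Solver.solve-∀
... | no c≰N = subst (Enumeration _ _) (sym binom-vanishes)
      (empty-enumeration λ B (_ , codim) → c≰N (subst (c ≤_) codim (m≤n+m c (count B N))))
  where
  N<c = ≰⇒> c≰N
  binom-vanishes : binomℤ (+ count P N) (+ (c + count P N) ℤ.- + N) ≡ 0
  binom-vanishes = begin
    binomℤ (+ count P N) (+ (c + count P N) ℤ.- + N) ≡⟨ cong (binomℤ _) (+m-+n≡+[m∸n] (≤-trans (<⇒≤ N<c) (m≤m+n c _))) ⟩
    count P N C (c + count P N ∸ N)                   ≡⟨ cong (count P N C_) (+-∸-comm (count P N) (<⇒≤ N<c)) ⟩
    count P N C (c ∸ N + count P N)                   ≡⟨ C-vanishes (m<n+m (count P N) (m<n⇒0<n∸m N<c)) ⟩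
    0                                                  ∎
    where open ≡-Reasoning

anyUpTo-characterises : ∀ f s → anyUpTo f s ≡ true ⇔ (Σ ℕ λ a → a ≤ s × f a ≡ true)
anyUpTo-characterises f zero    = (λ f0 → 0 , z≤n , f0) , λ { (zero , _ , f0) → f0 }
anyUpTo-characterises f (suc s) = fw , bw
  where
  fw : anyUpTo f (suc s) ≡ true → Σ ℕ λ a → a ≤ suc s × f a ≡ true
  fw = Sum.[ (λ fs → suc s , ≤-refl , fs)
           , (λ (a , a≤s , fa) → a , m≤n⇒m≤1+n a≤s , fa) ∘ proj₁ (anyUpTo-characterises f s) ]
     ∘ proj₁ (∨-≡-true (f (suc s)))
  bw : (Σ ℕ λ a → a ≤ suc s × f a ≡ true) → anyUpTo f (suc s) ≡ true
  bw (a , a≤1+s , fa) with m≤n⇒m<n∨m≡n a≤1+s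
  ... | inj₁ a<1+s = proj₂ (∨-≡-true (f (suc s)))
                       (inj₂ (proj₂ (anyUpTo-characterises f s) (a , ≤-pred a<1+s , fa)))
  ... | inj₂ refl  = proj₂ (∨-≡-true (f (suc s))) (inj₁ fa)

sumset-characterises : ∀ A → Characterises (sumset A)
                                  (λ s → Σ ℕ λ a₁ → Σ ℕ λ a₂ → a₁ ∈ A × a₂ ∈ A × a₁ + a₂ ≡ s)
sumset-characterises A s = fw , bw
  where
  fw : s ∈ sumset A → Σ ℕ λ a₁ → Σ ℕ λ a₂ → a₁ ∈ A × a₂ ∈ A × a₁ + a₂ ≡ s
  fw s∈A+A = let (a , a≤s , a∈A×s-a∈A) = proj₁ (anyUpTo-characterises _ s) s∈A+A
                 (a∈A , s-a∈A) = proj₁ (∧-≡-true (A a)) a∈A×s-a∈A in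
    a , s ∸ a , a∈A , s-a∈A , m+[n∸m]≡n a≤s
  bw : (Σ ℕ λ a₁ → Σ ℕ λ a₂ → a₁ ∈ A × a₂ ∈ A × a₁ + a₂ ≡ s) → s ∈ sumset A
  bw (a₁ , a₂ , a₁∈A , a₂∈A , refl) = proj₂ (anyUpTo-characterises _ (a₁ + a₂))
    (a₁ , m≤m+n a₁ a₂ , proj₂ (∧-≡-true (A a₁)) (a₁∈A , subst (_∈ A) (sym (m+n∸m≡n a₁ a₂)) a₂∈A))

sumsetUpTo-characterises : ∀ A k → Characterises (sumsetUpTo A k) (λ s → s ≤ k × s ∈ sumset A)
sumsetUpTo-characterises A k s with s ≤ᵇ k in s≤ᵇk
... | true  = (≤ᵇ⇒≤ s k (≡true⇒T s≤ᵇk) ,_) , proj₂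
... | false = (λ ()) , (λ (s≤k , _) → ⊥-elim (subst T s≤ᵇk (≤⇒≤ᵇ s≤k)))

-- Semigroups of type (A; k), with the multiplicity written as m = k + 1 + d

module TypeClassification (k d : ℕ) (A : SubsetN) (0<k : 0 < k) (A∈𝒜ₖ : InCalA k A) where

  m : ℕ
  m = suc (k + d)

  S : SubsetN
  S = sumsetUpTo A k

  a<k : ∀ {a} → a ∈ A → a < k
  a<k = proj₁ A∈𝒜ₖ _

  k∉A+A : ¬ k ∈ sumset A
  k∉A+A = proj₂ (proj₂ A∈𝒜ₖ) ∘ proj₁ (sumset-characterises A k)

  S⊆A+A : ∀ s → s ∈ S → s ∈ sumset A
  S⊆A+A s = proj₂ ∘ proj₁ (sumsetUpTo-characterises A k s)

  m+a<m+k+1 : ∀ {a} → a ∈ A → m + a < m + k + 1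
  m+a<m+k+1 {a} a∈A = subst (m + a <_) (sym (+-assoc m k 1)) (+-monoʳ-< m (≤-trans (a<k a∈A) (m≤m+n k 1)))

  k<m : k < m
  k<m = s≤s (m≤m+n k d)

  m+k+1+d≡2m : m + k + 1 + d ≡ 2 * m
  m+k+1+d≡2m = eq k d
    where
    eq : ∀ k d → suc (k + d) + k + 1 + d ≡ 2 * suc (k + d)
    eq = solve-∀

  m+k+1≤2m : m + k + 1 ≤ 2 * m
  m+k+1≤2m = subst (m + k + 1 ≤_) m+k+1+d≡2m (m≤m+n (m + k + 1) d)

  [m+a]+[m+b]≡2m+[a+b] : ∀ a b → m + a + (m + b) ≡ 2 * m + (a + b)
  [m+a]+[m+b]≡2m+[a+b] = eq m
    where
    eq : ∀ m a b → m + a + (m + b) ≡ 2 * m + (a + b)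
    eq = solve-∀

  f : ℕ
  f = 2 * m + k

  f+1≡2m+1+k : f + 1 ≡ 2 * m + suc k
  f+1≡2m+1+k = eq m k
    where
    eq : ∀ m k → 2 * m + k + 1 ≡ 2 * m + suc k
    eq = solve-∀

  tail : SubsetN
  tail = ⟦ f + 1 ≤?_ ⟧

  form : SubsetN → SubsetN
  form B = ⟦ _≟ 0 ⟧ ∪ m ⊕ A ∪ (2 * m) ⊕ S ∪ B ∪ tail

  Unforced : ℕ → Set
  Unforced n = (m + k + 1 ≤ n) × (n < f) × ¬ (Σ ℕ λ s → s ∈ sumset A × n ≡ 2 * m + s)

  unforced : SubsetN
  unforced = ⟦ m + k + 1 ≤?_ ⟧ ∩ ⟦ _<? f ⟧ ∖ (2 * m) ⊕ sumset A

  unforced-characterises : Characterises unforced Unforced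
  unforced-characterises = ∩-characterises (⟦⟧-characterises (m + k + 1 ≤?_))
    (∖-characterises (⟦⟧-characterises (_<? f)) (⊕-characterises (2 * m) (∈-characterises (sumset A))))

  tail-below : ∀ {n} → n < f + 1 → tail n ≡ false
  tail-below {n} n<f+1 = ¬≡true⇒≡false (<⇒≱ n<f+1 ∘ proj₁ (⟦⟧-characterises (f + 1 ≤?_) n))

  count-zero : count ⟦ _≟ 0 ⟧ (f + 1) ≡ 1
  count-zero = trans (cong (count ⟦ _≟ 0 ⟧) (+-comm f 1))
                     (trans (count-+ ⟦ _≟ 0 ⟧ 1 f) (cong suc (count-none _ f λ _ _ → refl)))

  count-shifted-A : count (m ⊕ A) (f + 1) ≡ count A k
  count-shifted-A = trans (cong (count (m ⊕ A)) (eq m k)) (trans (count-⊕ m A (m + k + 1))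
    (count-stable A (≤-trans (m≤n+m k m) (m≤m+n (m + k) 1))
      (λ n k≤n → ¬≡true⇒≡false λ n∈A → <⇒≱ (a<k n∈A) k≤n)))
    where
    eq : ∀ m k → 2 * m + k + 1 ≡ m + (m + k + 1)
    eq = solve-∀

  count-shifted-S : count ((2 * m) ⊕ S) (f + 1) ≡ count S (suc k)
  count-shifted-S = trans (cong (count ((2 * m) ⊕ S)) f+1≡2m+1+k) (count-⊕ (2 * m) S (suc k))

  Rest₃ Rest₂ : SubsetN → ℕ → Set
  Rest₃ B n = n ∈ B ⊎ f + 1 ≤ n
  Rest₂ B n = (Σ ℕ λ s → s ∈ S × n ≡ 2 * m + s) ⊎ Rest₃ B n

  module _ (B : SubsetN) where

    rest₃-characterises : Characterises (B ∪ tail) (Rest₃ B)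
    rest₃-characterises = ∪-characterises (∈-characterises B) (⟦⟧-characterises (f + 1 ≤?_))

    rest₂-characterises : Characterises ((2 * m) ⊕ S ∪ B ∪ tail) (Rest₂ B)
    rest₂-characterises = ∪-characterises (⊕-characterises (2 * m) (∈-characterises S)) rest₃-characterises

    rest₁-characterises : Characterises (m ⊕ A ∪ (2 * m) ⊕ S ∪ B ∪ tail)
                                        (λ n → (Σ ℕ λ a → a ∈ A × n ≡ m + a) ⊎ Rest₂ B n)
    rest₁-characterises = ∪-characterises (⊕-characterises m (∈-characterises A)) rest₂-characterises

    form-characterises : Characterises (form B) (InForm m k A B)
    form-characterises = ∪-characterises (⟦⟧-characterises (_≟ 0)) rest₁-characterises

  UnforcedSet : SubsetN → Set
  UnforcedSet B = ∀ n → n ∈ B → Unforced n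

  HasForm : SubsetN → SubsetN → Set
  HasForm B Λ = Characterises Λ (InForm m k A B)

  module _ {B : SubsetN} (B-unforced : UnforcedSet B) where

    Rest₂-bound : ∀ {n} → Rest₂ B n → m + k + 1 ≤ n
    Rest₂-bound (inj₁ (s , _ , refl))  = ≤-trans m+k+1≤2m (m≤m+n (2 * m) s)
    Rest₂-bound (inj₂ (inj₁ n∈B))     = proj₁ (B-unforced _ n∈B)
    Rest₂-bound (inj₂ (inj₂ tail≤n))  = ≤-trans (+-monoˡ-≤ 1 (+-monoˡ-≤ k (m≤m+n m (m + 0)))) tail≤n

    Rest₃-unforced : ∀ {n} → n < f + 1 → Rest₃ B n → Unforced n
    Rest₃-unforced {n} n<tail = Sum.[ B-unforced n , (λ tail≤n → contradiction tail≤n (<⇒≱ n<tail)) ]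

    NonZero : ℕ → Set
    NonZero n = (Σ ℕ λ a → a ∈ A × n ≡ m + a) ⊎ m + k + 1 ≤ n

    NonZero⇒m≤ : ∀ {n} → NonZero n → m ≤ n
    NonZero⇒m≤ (inj₁ (a , _ , refl)) = m≤m+n m a
    NonZero⇒m≤ (inj₂ m+k+1≤n)        = ≤-trans (≤-trans (m≤m+n m k) (m≤m+n (m + k) 1)) m+k+1≤n

    InForm-trichotomy : ∀ {n} → InForm m k A B n → n ≡ 0 ⊎ NonZero n
    InForm-trichotomy = Sum.map₂ (Sum.map₂ Rest₂-bound)

    zero-disjoint : ∀ n → n ∈ ⟦ _≟ 0 ⟧ → (m ⊕ A ∪ (2 * m) ⊕ S ∪ B ∪ tail) n ≡ false
    zero-disjoint n n≟0 = ¬≡true⇒≡false λ n∈rest →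
      contradiction (subst (m ≤_) (proj₁ (⟦⟧-characterises (_≟ 0) n) n≟0)
                      (NonZero⇒m≤ (Sum.map₂ Rest₂-bound (proj₁ (rest₁-characterises B n) n∈rest)))) λ ()

    shifted-A-disjoint : ∀ n → n ∈ m ⊕ A → ((2 * m) ⊕ S ∪ B ∪ tail) n ≡ false
    shifted-A-disjoint n n∈m+A = ¬≡true⇒≡false λ n∈rest →
      let (a , a∈A , n≡m+a) = proj₁ (⊕-characterises m (∈-characterises A) n) n∈m+A in
      contradiction (Rest₂-bound (proj₁ (rest₂-characterises B n) n∈rest))
        (<⇒≱ (subst (_< m + k + 1) (sym n≡m+a) (m+a<m+k+1 a∈A)))

    shifted-S-disjoint : ∀ n → n < f + 1 → n ∈ (2 * m) ⊕ S → (B ∪ tail) n ≡ false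
    shifted-S-disjoint n n<f+1 n∈2m+S = ¬≡true⇒≡false λ n∈rest →
      let (s , s∈S , n≡2m+s) = proj₁ (⊕-characterises (2 * m) (∈-characterises S) n) n∈2m+S in
      proj₂ (proj₂ (Rest₃-unforced n<f+1 (proj₁ (rest₃-characterises B n) n∈rest))) (s , S⊆A+A s s∈S , n≡2m+s)

    count-B : count B (f + 1) ≡ count B f
    count-B = count-stable B (m≤m+n f 1)
                (λ n f≤n → ¬≡true⇒≡false λ n∈B → <⇒≱ (proj₁ (proj₂ (B-unforced n n∈B))) f≤n)

    count-form : count (form B) (f + 1) ≡ suc (count A k + (count S (suc k) + count B f))
    count-form = begin
      count (form B) (f + 1)
        ≡⟨ count-∪ _ _ (f + 1) (λ n _ → zero-disjoint n) ⟩
      count ⟦ _≟ 0 ⟧ (f + 1) + count (m ⊕ A ∪ (2 * m) ⊕ S ∪ B ∪ tail) (f + 1)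
        ≡⟨ cong₂ _+_ count-zero (count-∪ _ _ (f + 1) (λ n _ → shifted-A-disjoint n)) ⟩
      1 + (count (m ⊕ A) (f + 1) + count ((2 * m) ⊕ S ∪ B ∪ tail) (f + 1))
        ≡⟨ cong (λ x → 1 + (count (m ⊕ A) (f + 1) + x)) (count-∪ _ _ (f + 1) shifted-S-disjoint) ⟩
      1 + (count (m ⊕ A) (f + 1) + (count ((2 * m) ⊕ S) (f + 1) + count (B ∪ tail) (f + 1)))
        ≡⟨ cong (λ x → 1 + (count (m ⊕ A) (f + 1) + (count ((2 * m) ⊕ S) (f + 1) + x)))
                (count-∪ _ _ (f + 1) (λ n n<f+1 _ → tail-below n<f+1)) ⟩
      1 + (count (m ⊕ A) (f + 1) + (count ((2 * m) ⊕ S) (f + 1) + (count B (f + 1) + count tail (f + 1))))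
        ≡⟨ cong (λ x → 1 + (count (m ⊕ A) (f + 1) + (count ((2 * m) ⊕ S) (f + 1) + x)))
                (trans (cong₂ _+_ count-B (count-none tail (f + 1) (λ n → tail-below))) (+-identityʳ _)) ⟩
      1 + (count (m ⊕ A) (f + 1) + (count ((2 * m) ⊕ S) (f + 1) + count B f))
        ≡⟨ cong₂ (λ x y → 1 + (x + (y + count B f))) count-shifted-A count-shifted-S ⟩
      suc (count A k + (count S (suc k) + count B f))
        ∎
      where open ≡-Reasoning

    module _ {Λ : SubsetN} (Λ-form : HasForm B Λ) where

      tail⊆Λ : ∀ n → f + 1 ≤ n → n ∈ Λ
      tail⊆Λ n tail≤n = proj₂ (Λ-form n) (inj₂ (inj₂ (inj₂ (inj₂ tail≤n))))

      form-isNumericalSemigroup : IsNumericalSemigroup Λ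
      form-isNumericalSemigroup = record
        { zero∈    = proj₂ (Λ-form 0) (inj₁ refl)
        ; closed   = closed
        ; cofinite = f + 1 , tail⊆Λ
        }
        where
        beyond : ∀ {x y} → m + k + 1 ≤ x → m ≤ y → x + y ∈ Λ
        beyond {x} {y} m+k+1≤x m≤y = tail⊆Λ (x + y) (subst (_≤ x + y) (eq m k) (+-mono-≤ m+k+1≤x m≤y))
          where
          eq : ∀ m k → m + k + 1 + m ≡ 2 * m + k + 1
          eq = solve-∀

        nonzero-closed : ∀ {x y} → NonZero x → NonZero y → x + y ∈ Λ
        nonzero-closed (inj₂ m+k+1≤x) y≠0 = beyond m+k+1≤x (NonZero⇒m≤ y≠0)
        nonzero-closed {x} {y} x≠0 (inj₂ m+k+1≤y) =
          subst (_∈ Λ) (+-comm y x) (beyond m+k+1≤y (NonZero⇒m≤ x≠0))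
        nonzero-closed (inj₁ (a₁ , a₁∈A , refl)) (inj₁ (a₂ , a₂∈A , refl)) with a₁ + a₂ ≤? k
        ... | yes a₁+a₂≤k = proj₂ (Λ-form _) (inj₂ (inj₂ (inj₁ (a₁ + a₂ ,
                proj₂ (sumsetUpTo-characterises A k _)
                  (a₁+a₂≤k , proj₂ (sumset-characterises A _) (a₁ , a₂ , a₁∈A , a₂∈A , refl)) ,
                [m+a]+[m+b]≡2m+[a+b] a₁ a₂))))
        ... | no  a₁+a₂≰k = tail⊆Λ _ (subst₂ _≤_ (sym f+1≡2m+1+k) (sym ([m+a]+[m+b]≡2m+[a+b] a₁ a₂))
                                              (+-monoʳ-≤ (2 * m) (≰⇒> a₁+a₂≰k)))

        closed : ∀ x y → x ∈ Λ → y ∈ Λ → x + y ∈ Λ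
        closed x y x∈Λ y∈Λ
          with InForm-trichotomy (proj₁ (Λ-form x) x∈Λ) | InForm-trichotomy (proj₁ (Λ-form y) y∈Λ)
        ... | inj₁ refl | _         = y∈Λ
        ... | inj₂ x≠0  | inj₁ refl = subst (_∈ Λ) (sym (+-identityʳ x)) x∈Λ
        ... | inj₂ x≠0  | inj₂ y≠0  = nonzero-closed x≠0 y≠0

      form-multiplicity : Multiplicity Λ m
      form-multiplicity = s≤s z≤n , proj₂ (Λ-form m) (inj₂ (inj₁ (0 , 0∈A , sym (+-identityʳ m)))) , below-m
        where
        0∈A = proj₁ (proj₂ A∈𝒜ₖ)
        below-m : ∀ n → 0 < n → n < m → ¬ n ∈ Λ
        below-m n 0<n n<m n∈Λ with InForm-trichotomy (proj₁ (Λ-form n) n∈Λ)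
        ... | inj₁ refl = n≮0 0<n
        ... | inj₂ n≠0  = <⇒≱ n<m (NonZero⇒m≤ n≠0)

      frobenius∉Λ : ¬ f ∈ Λ
      frobenius∉Λ f∈Λ with proj₁ (Λ-form _) f∈Λ
      ... | inj₁ ()
      ... | inj₂ (inj₁ (a , a∈A , f≡m+a)) = <⇒≱ (a<k a∈A)
              (subst (k ≤_) (+-cancelˡ-≡ m _ _ (trans (sym (eq m k)) f≡m+a)) (m≤n+m k m))
        where
        eq : ∀ m k → 2 * m + k ≡ m + (m + k)
        eq = solve-∀
      ... | inj₂ (inj₂ (inj₁ (s , s∈S , f≡2m+s))) = k∉A+A
              (subst (_∈ sumset A) (sym (+-cancelˡ-≡ (2 * m) _ _ f≡2m+s)) (S⊆A+A s s∈S))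
      ... | inj₂ (inj₂ (inj₂ (inj₁ f∈B)))     = n≮n _ (proj₁ (proj₂ (B-unforced _ f∈B)))
      ... | inj₂ (inj₂ (inj₂ (inj₂ tail≤f)))  = <⇒≱ (m<m+n f (s≤s z≤n)) tail≤f

      form-hasType : HasType Λ m A k
      form-hasType = f , (frobenius∉Λ , above) , m<m+n (2 * m) 0<k , 2m+k<3m , refl , 0<k , k<m , A∈𝒜ₖ , window
        where
        above : ∀ n → f < n → n ∈ Λ
        above n f<n = tail⊆Λ n (subst (_≤ n) (sym (+-comm f 1)) f<n)
        2m+k<3m : f < 3 * m
        2m+k<3m = subst (f <_) (eq m) (+-monoʳ-< (2 * m) k<m)
          where
          eq : ∀ m → 2 * m + m ≡ 3 * m
          eq = solve-∀
        window : ∀ n → (m ≤ n × n ≤ m + k × n ∈ Λ) ⇔ (Σ ℕ λ a → a ∈ A × n ≡ a + m)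
        window n = fw , bw
          where
          fw : m ≤ n × n ≤ m + k × n ∈ Λ → Σ ℕ λ a → a ∈ A × n ≡ a + m
          fw (m≤n , n≤m+k , n∈Λ) with InForm-trichotomy (proj₁ (Λ-form n) n∈Λ)
          ... | inj₁ refl                       = contradiction m≤n λ ()
          ... | inj₂ (inj₁ (a , a∈A , n≡m+a))   = a , a∈A , trans n≡m+a (+-comm m a)
          ... | inj₂ (inj₂ m+k+1≤n)             =
                contradiction (≤-trans m+k+1≤n n≤m+k) (<⇒≱ (m<m+n (m + k) (s≤s z≤n)))
          bw : (Σ ℕ λ a → a ∈ A × n ≡ a + m) → m ≤ n × n ≤ m + k × n ∈ Λ
          bw (a , a∈A , refl) = m≤n+m m a , subst (_≤ m + k) (+-comm m a) (+-monoʳ-≤ m (<⇒≤ (a<k a∈A)))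
                              , proj₂ (Λ-form _) (inj₂ (inj₁ (a , a∈A , +-comm a m)))

      gaps-equation : count B f + count A k + count S (suc k) + countNot Λ (f + 1) ≡ f
      gaps-equation = suc-injective (begin
        suc (count B f + count A k + count S (suc k) + countNot Λ N)
          ≡⟨ cong suc (eq (count B f) (count A k) (count S (suc k)) (countNot Λ N)) ⟩
        suc (count A k + (count S (suc k) + count B f)) + countNot Λ N
          ≡⟨ cong (_+ countNot Λ N) count-Λ ⟨
        count Λ N + countNot Λ N
          ≡⟨ count+countNot Λ N ⟩
        N
          ≡⟨ +-comm f 1 ⟩
        suc f
          ∎)
        where
        open ≡-Reasoning
        N = f + 1
        eq : ∀ b a s x → b + a + s + x ≡ a + (s + b) + x
        eq = solve-∀
        count-Λ : count Λ N ≡ suc (count A k + (count S (suc k) + count B f))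
        count-Λ = trans (count-cong N (λ n _ → characterises-≐ Λ-form (form-characterises B) n)) count-form

  hasForm⇒semigroupOfType : ∀ {g B Λ} → ValidB m k A g B → HasForm B Λ → SemigroupOfType m A k g Λ
  hasForm⇒semigroupOfType {g} {B} {Λ} (B-unforced , size) Λ-form =
      form-isNumericalSemigroup B-unforced Λ-form
    , form-multiplicity B-unforced Λ-form
    , form-hasType B-unforced Λ-form
    , (f + 1 , tail⊆Λ B-unforced Λ-form ,
       +-cancelˡ-≡ (count B f + count A k + count S (suc k)) _ _
         (trans (gaps-equation B-unforced Λ-form) (sym size)))

  semigroupOfType⇒hasForm : ∀ {g Λ} → SemigroupOfType m A k g Λ → HasForm (Λ ∩ unforced) Λ
  semigroupOfType⇒hasForm {Λ = Λ}
    (ns , (_ , _ , below-m) , (_ , (f∉Λ , above-f) , _ , _ , refl , _ , _ , _ , window) , _) n = fw , bw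
    where
    open IsNumericalSemigroup ns

    m+a∈Λ : ∀ {a} → a ∈ A → m + a ∈ Λ
    m+a∈Λ {a} a∈A = proj₂ (proj₂ (proj₂ (window (m + a)) (a , a∈A , +-comm m a)))

    2m+A+A-characterises = ⊕-characterises (2 * m) (∈-characterises (sumset A))

    beyond-f : n ∈ Λ → ¬ n < f → f + 1 ≤ n
    beyond-f n∈Λ n≮f = subst (_≤ n) (+-comm 1 f) (≤∧≢⇒< (≮⇒≥ n≮f) λ f≡n → f∉Λ (subst (_∈ Λ) (sym f≡n) n∈Λ))

    below-f : n < f → (Σ ℕ λ s → s ∈ sumset A × n ≡ 2 * m + s) → Σ ℕ λ s → s ∈ S × n ≡ 2 * m + s
    below-f n<f (s , s∈A+A , n≡2m+s) =
      s , proj₂ (sumsetUpTo-characterises A k s) (<⇒≤ (+-cancelˡ-< (2 * m) s k (subst (_< f) n≡2m+s n<f)) , s∈A+A)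
        , n≡2m+s

    fw : n ∈ Λ → InForm m k A (Λ ∩ unforced) n
    fw n∈Λ with n <? m
    ... | yes n<m with n ≟ 0
    ...   | yes n≡0 = inj₁ n≡0
    ...   | no  n≢0 = contradiction n∈Λ (below-m n (n≢0⇒n>0 n≢0) n<m)
    fw n∈Λ | no n≮m with n ≤? m + k
    ...   | yes n≤m+k = let (a , a∈A , n≡a+m) = proj₁ (window n) (≮⇒≥ n≮m , n≤m+k , n∈Λ) in
                        inj₂ (inj₁ (a , a∈A , trans n≡a+m (+-comm a m)))
    ...   | no  n≰m+k with n <? f
    ...     | no  n≮f = inj₂ (inj₂ (inj₂ (inj₂ (beyond-f n∈Λ n≮f))))
    ...     | yes n<f with ((2 * m) ⊕ sumset A) n Bool.≟ true
    ...       | yes n∈2m+A+A = inj₂ (inj₂ (inj₁ (below-f n<f (proj₁ (2m+A+A-characterises n) n∈2m+A+A))))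
    ...       | no  n∉2m+A+A = inj₂ (inj₂ (inj₂ (inj₁ (proj₂ (∧-≡-true (Λ n)) (n∈Λ , n∈unforced)))))
      where
      n∈unforced = proj₂ (unforced-characterises n)
        ( subst (_≤ n) (+-comm 1 (m + k)) (≰⇒> n≰m+k) , n<f
        , n∉2m+A+A ∘ proj₂ (2m+A+A-characterises n))

    bw : InForm m k A (Λ ∩ unforced) n → n ∈ Λ
    bw (inj₁ refl)                                  = zero∈
    bw (inj₂ (inj₁ (a , a∈A , refl)))               = m+a∈Λ a∈A
    bw (inj₂ (inj₂ (inj₁ (s , s∈S , refl))))        =
      let (a₁ , a₂ , a₁∈A , a₂∈A , a₁+a₂≡s) = proj₁ (sumset-characterises A s) (S⊆A+A s s∈S) in
      subst (_∈ Λ) (trans ([m+a]+[m+b]≡2m+[a+b] a₁ a₂) (cong (λ x → 2 * m + x) a₁+a₂≡s))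
                   (closed _ _ (m+a∈Λ a₁∈A) (m+a∈Λ a₂∈A))
    bw (inj₂ (inj₂ (inj₂ (inj₁ n∈Λ∩unforced))))    = proj₁ (proj₁ (∧-≡-true (Λ n)) n∈Λ∩unforced)
    bw (inj₂ (inj₂ (inj₂ (inj₂ f+1≤n))))           = above-f n (subst (_≤ n) (+-comm f 1) f+1≤n)

  ∩unforced-isUnforced : ∀ Λ → UnforcedSet (Λ ∩ unforced)
  ∩unforced-isUnforced Λ n n∈Λ∩unforced =
    proj₁ (unforced-characterises n) (proj₂ (proj₁ (∧-≡-true (Λ n)) n∈Λ∩unforced))

  semigroupOfType⇒validB : ∀ {g Λ} → SemigroupOfType m A k g Λ → ValidB m k A g (Λ ∩ unforced)
  semigroupOfType⇒validB {g} {Λ} Λ-type@(_ , _ , _ , (N , N≤⇒∈Λ , gaps≡g)) =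
    ∩unforced-isUnforced Λ
    , subst (λ x → _ + x ≡ f) gaps-at-tail (gaps-equation (∩unforced-isUnforced Λ) Λ-form)
    where
    Λ-form = semigroupOfType⇒hasForm Λ-type
    N′ = f + 1
    gaps-at-tail : countNot Λ N′ ≡ g
    gaps-at-tail = begin
      countNot Λ N′        ≡⟨ countNot-stable Λ (m≤m+n N′ N) (tail⊆Λ (∩unforced-isUnforced Λ) Λ-form) ⟨
      countNot Λ (N′ + N)  ≡⟨ countNot-stable Λ (m≤n+m N N′) N≤⇒∈Λ ⟩
      countNot Λ N         ≡⟨ gaps≡g ⟩
      g                    ∎
      where open ≡-Reasoning

  classification : ∀ g Λ → SemigroupOfType m A k g Λ ⇔ (Σ SubsetN λ B → ValidB m k A g B × HasForm B Λ)
  classification g Λ =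
      (λ Λ-type → Λ ∩ unforced , semigroupOfType⇒validB Λ-type , semigroupOfType⇒hasForm Λ-type)
    , (λ (B , B-valid , Λ-form) → hasForm⇒semigroupOfType B-valid Λ-form)

  form-unforced : ∀ B {n} → n ∈ unforced → form B n ≡ B n
  form-unforced B {n} n∈unforced =
    ≡-true-ext _ _ ( fw ∘ proj₁ (form-characterises B n)
                   , proj₂ (form-characterises B n) ∘ inj₂ ∘ inj₂ ∘ inj₂ ∘ inj₁)
    where
    n-unforced = proj₁ (unforced-characterises n) n∈unforced
    fw : InForm m k A B n → n ∈ B
    fw (inj₁ refl)                           = contradiction (proj₁ n-unforced) λ ()
    fw (inj₂ (inj₁ (a , a∈A , refl)))        = contradiction (proj₁ n-unforced) (<⇒≱ (m+a<m+k+1 a∈A))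
    fw (inj₂ (inj₂ (inj₁ (s , s∈S , n≡))))   = contradiction (s , S⊆A+A s s∈S , n≡) (proj₂ (proj₂ n-unforced))
    fw (inj₂ (inj₂ (inj₂ (inj₁ n∈B))))       = n∈B
    fw (inj₂ (inj₂ (inj₂ (inj₂ tail≤n))))    =
      contradiction tail≤n (<⇒≱ (<-trans (proj₁ (proj₂ n-unforced)) (m<m+n f (s≤s z≤n))))

  count-unforced : suc (count unforced f + count S (suc k)) ≡ m
  count-unforced = begin
    suc (count unforced f + count S (suc k))
      ≡⟨ cong₂ (λ x y → suc (x + y)) count-unforced-window count-S ⟩
    suc (d + countNot (sumset A) k + count (sumset A) k)
      ≡⟨ cong suc (+-assoc d _ _) ⟩
    suc (d + (countNot (sumset A) k + count (sumset A) k))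
      ≡⟨ cong (λ x → suc (d + x)) (trans (+-comm (countNot (sumset A) k) _) (count+countNot (sumset A) k)) ⟩
    suc (d + k)
      ≡⟨ cong suc (+-comm d k) ⟩
    m
      ∎
    where
    open ≡-Reasoning
    a = m + k + 1

    unforced-below : ∀ n → n < a → unforced n ≡ false
    unforced-below n n<a = ¬≡true⇒≡false λ n∈unforced →
      <⇒≱ n<a (proj₁ (proj₁ (unforced-characterises n) n∈unforced))

    unforced-middle : ∀ i → i < d → a + i ∈ unforced
    unforced-middle i i<d = proj₂ (unforced-characterises (a + i))
      (m≤m+n a i , <-≤-trans a+i<2m (m≤m+n (2 * m) k) ,
       λ (s , _ , a+i≡2m+s) → <⇒≱ a+i<2m (subst (2 * m ≤_) (sym a+i≡2m+s) (m≤m+n (2 * m) s)))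
      where
      a+i<2m : a + i < 2 * m
      a+i<2m = subst (a + i <_) m+k+1+d≡2m (+-monoʳ-< a i<d)

    unforced-upper : ∀ i → i < k → unforced (a + (d + i)) ≡ not (sumset A i)
    unforced-upper i i<k = trans (cong unforced (eq k d i)) (≡-true-ext _ _ (fw , bw))
      where
      eq : ∀ k d i → suc (k + d) + k + 1 + (d + i) ≡ 2 * suc (k + d) + i
      eq = solve-∀
      fw : 2 * m + i ∈ unforced → not (sumset A i) ≡ true
      fw u = proj₂ (not-≡-true (sumset A i)) λ i∈A+A →
        proj₂ (proj₂ (proj₁ (unforced-characterises _) u)) (i , i∈A+A , refl)
      bw : not (sumset A i) ≡ true → 2 * m + i ∈ unforced
      bw i∉A+A = proj₂ (unforced-characterises _) (≤-trans m+k+1≤2m (m≤m+n (2 * m) i) , +-monoʳ-< (2 * m) i<k ,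
        λ (s , s∈A+A , 2m+i≡2m+s) → proj₁ (not-≡-true (sumset A i)) i∉A+A
                                      (subst (_∈ sumset A) (sym (+-cancelˡ-≡ (2 * m) i s 2m+i≡2m+s)) s∈A+A))

    count-unforced-window : count unforced f ≡ d + countNot (sumset A) k
    count-unforced-window = begin
      count unforced f
        ≡⟨ cong (count unforced) (eq k d) ⟩
      count unforced (a + (d + k))
        ≡⟨ count-+ unforced a (d + k) ⟩
      count unforced a + count (λ i → unforced (a + i)) (d + k)
        ≡⟨ cong₂ _+_ (count-none unforced a unforced-below) (count-+ _ d k) ⟩
      count (λ i → unforced (a + i)) d + count (λ i → unforced (a + (d + i))) k
        ≡⟨ cong₂ _+_ (count-all _ d unforced-middle) (count-cong k unforced-upper) ⟩
      d + count (not ∘ sumset A) k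
        ≡⟨ cong (λ x → d + x) (count-not (sumset A) k) ⟩
      d + countNot (sumset A) k
        ∎
      where
      eq : ∀ k d → 2 * suc (k + d) + k ≡ suc (k + d) + k + 1 + (d + k)
      eq = solve-∀

    count-S : count S (suc k) ≡ count (sumset A) k
    count-S = trans (count-suc-false S k (¬≡true⇒≡false (k∉A+A ∘ S⊆A+A k)))
                    (count-cong k λ i i<k → ≡-true-ext _ _
                      (S⊆A+A i , λ i∈A+A → proj₂ (sumsetUpTo-characterises A k i) (<⇒≤ i<k , i∈A+A)))

  cardinality : ∀ g → HasCardinality (SemigroupOfType m A k g)
    (binomℤ (+ m ℤ.- + 1 ℤ.- + count S (suc k)) (+ g ℤ.+ + count A k ℤ.- + m ℤ.- + k ℤ.- + 1))
  cardinality g = subst (HasCardinality _) binom-eq (Enumeration⇒HasCardinality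
    (Enumeration-map form (_∩ unforced) form-apart form-cong codim⇒type type⇒codim
      (codimension-enumeration unforced f (count A k + count S (suc k) + g))))
    where
    cp = count unforced f
    cA = count A k
    cS = count S (suc k)

    binom-eq : binomℤ (+ cp) (+ (cA + cS + g + cp) ℤ.- + f)
             ≡ binomℤ (+ m ℤ.- + 1 ℤ.- + cS) (+ g ℤ.+ + cA ℤ.- + m ℤ.- + k ℤ.- + 1)
    binom-eq = sym (cong₂ binomℤ (upper-index cp cS count-unforced) (lower-index cp cS cA g k count-unforced))

    size-eq : ∀ b → b + (cA + cS + g) ≡ b + cA + cS + g
    size-eq b = eq b cA cS g
      where
      eq : ∀ b a s g → b + (a + s + g) ≡ b + a + s + g
      eq = solve-∀

    form-apart : ∀ {B B′} → Apart (unforced ∩ below f) B B′ → Apart unforced (form B) (form B′)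
    form-apart {B} {B′} (n , n∈unforced∩below , Bn≢B′n) =
      let n∈unforced = proj₁ (proj₁ (∩below-characterises unforced f n) n∈unforced∩below) in
      n , n∈unforced
        , λ eq → Bn≢B′n (trans (sym (form-unforced B n∈unforced)) (trans eq (form-unforced B′ n∈unforced)))

    form-cong : ∀ {B B′} → B ≐ B′ → form B ≐ form B′
    form-cong B≐B′ n = cong (λ b → does (n ≟ 0) ∨ ((m ⊕ A) n ∨ (((2 * m) ⊕ S) n ∨ (b ∨ tail n)))) (B≐B′ n)

    codim⇒type : ∀ {B} → Support unforced f B × count B f + (cA + cS + g) ≡ f
               → SemigroupOfType m A k g (form B)
    codim⇒type {B} (supp , codim) = hasForm⇒semigroupOfType
      ((λ n n∈B → proj₁ (unforced-characterises n) (proj₂ (supp n n∈B))) , trans (sym (size-eq _)) codim)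
      (form-characterises B)

    type⇒codim : ∀ {Λ} → SemigroupOfType m A k g Λ
               → (Support unforced f (Λ ∩ unforced) × count (Λ ∩ unforced) f + (cA + cS + g) ≡ f)
                 × Λ ≐ form (Λ ∩ unforced)
    type⇒codim {Λ} Λ-type = let (B-unforced , size) = semigroupOfType⇒validB Λ-type in
        ((λ n n∈B → proj₁ (proj₂ (B-unforced n n∈B)) , proj₂ (unforced-characterises n) (B-unforced n n∈B))
        , trans (size-eq _) size)
      , characterises-≐ (semigroupOfType⇒hasForm Λ-type) (form-characterises (Λ ∩ unforced))

corollary3p4 : (m k g : ℕ) → 0 < m → 0 < k → 0 < g → k < m
    → (A : SubsetN) → InCalA k A
    → ((Λ : SubsetN) → SemigroupOfType m A k g Λ
    ⇔ (Σ SubsetN λ B → ValidB m k A g B × (∀ n → n ∈ Λ ⇔ InForm m k A B n)))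
    × HasCardinality (SemigroupOfType m A k g)
    (binomℤ ((+ m) ℤ.- (+ 1) ℤ.- (+ (count (sumsetUpTo A k) (suc k))))
    ((+ g) ℤ.+ (+ (count A k)) ℤ.- (+ m) ℤ.- (+ k) ℤ.- (+ 1)))
corollary3p4 m k g _ 0<k _ k<m A A∈𝒜ₖ with m ∸ suc k | m+[n∸m]≡n k<m
... | d | refl = classification g , cardinality g
  where open TypeClassification k d A 0<k A∈𝒜ₖ
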